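{- Let $r$ and $k\geq 3$ be positive integers. Let $j\ge 1$, let $E(K_k)=E_1\cup\cdots\cup E_j$ be a partition of the edge set of the complete graph $K_k$, and let $s_1,\dots,s_j$ be integers with $1\le s_i\le r$ such that $$r\left\lfloor \frac{k}{2}\right\rfloor<\sum_{i=1}^j |E_i|\,s_i.$$ Then for any assignment of color lists $L_e\subseteq[r]$ to the edges $e$ of $K_k$ such that, for each $i$, every edge $e\in E_i$ has $|L_e|\ge s_i$, there exists a triangle in $K_k$ two of whose edges have lists with non-empty intersection. -}

module Defs where

open import Data.Nat using (ℕ)
open import Data.Fin using (Fin; _<_; _<?_)
open import Data.Fin.Properties using (_≟_)
open import Data.Product using (Σ; _×_; _,_; proj₁)
open import Data.List using (List; []; _∷_; allFin; concatMap; filter; length; map; mapMaybe)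
open import Data.Nat.ListAction using (sum)
open import Data.Maybe using (Maybe; just; nothing)
open import Relation.Nullary using (yes; no)
open import Relation.Binary.PropositionalEquality using (_≡_)

-- An edge of K_k on vertex set Fin k: an unordered pair {u,v}, represented
-- canonically as (u , v) with u < v.
Edge : ℕ → Set
Edge k = Σ (Fin k × Fin k) λ p → proj₁ p < Data.Product.proj₂ p

mkEdge : ∀ {k} → Fin k → Fin k → Maybe (Edge k)
mkEdge u v with u <? v
... | yes u<v = just ((u , v) , u<v)
... | no _ = nothing

edges : (k : ℕ) → List (Edge k)
edges k = concatMap (λ u → mapMaybe (mkEdge u) (allFin k)) (allFin k)

-- |E_i| for the partition given by the class map cls : Edge k → Fin j,
-- where E_i = { e | cls e ≡ i }.
classSize : ∀ {k j} → (Edge k → Fin j) → Fin j → ℕ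
classSize {k} cls i = length (filter (λ e → cls e ≟ i) (edges k))

weightedSum : ∀ {k j} → (Edge k → Fin j) → (Fin j → ℕ) → ℕ
weightedSum {j = j} cls s = sum (map (λ i → classSize cls i Data.Nat.* s i) (allFin j))

module Submission where

-- For a colour c, call the edges whose list contains c the c-class. If some vertex
-- met two edges of the c-class, those two edges would span a triangle with two
-- intersecting lists. Otherwise every c-class is a matching of K_k and so has at
-- most ⌊k/2⌋ edges, and double counting gives
--   ∑ᵢ |Eᵢ| sᵢ = ∑ₑ s_{cls e} ≤ ∑ₑ |Lₑ| = ∑_c |c-class| ≤ r ⌊k/2⌋,
-- contradicting the hypothesis.

open import Defs
open import Data.Nat using (ℕ; _≤_; _<_; _/_; _*_)
open import Data.Fin using (Fin)
open import Data.Fin.Subset using (Subset; ∣_∣; _∩_; Nonempty)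
open import Data.Product using (Σ; ∃; _×_; _,_)
open import Data.Sum using (_⊎_)
open import Relation.Binary.PropositionalEquality using (_≡_)

open import Data.Nat using (zero; suc; _+_; z≤n; s≤s; _≤?_)
open import Data.Nat.Properties
open import Data.Nat.DivMod using (m*n/n≡m; /-monoˡ-≤)
open import Data.Nat.ListAction.Properties using (sum-++)
open import Algebra.Properties.CommutativeSemigroup +-commutativeSemigroup using (interchange)
open import Data.Fin as Fin using (zero; suc)
import Data.Fin.Properties as Finₚ
open import Data.Fin.Subset using (_∈_)
open import Data.Fin.Subset.Properties using (_∈?_; x∈p∩q⁺)
open import Data.List using (List; []; _∷_; allFin; concatMap; filter; length; map; mapMaybe; _++_)
open import Data.List.Properties using (map-tabulate; length-tabulate; map-++)
open import Data.Nat.ListAction using (sum)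
open import Data.Maybe using (Maybe; just; nothing; maybe′)
open import Data.Vec using (_∷_; [])
open import Data.Bool using (true; false; if_then_else_)
open import Data.Empty using (⊥-elim)
open import Data.Sum using (inj₁; inj₂)
open import Function using (_∘_)
open import Relation.Nullary using (Dec; yes; no; does)
open import Relation.Binary.Definitions using (tri<; tri≈; tri>)
open import Relation.Binary.PropositionalEquality using (refl; sym; trans; cong; cong₂; subst; _≢_; module ≡-Reasoning)

𝟙 : ∀ {a} {A : Set a} → Dec A → ℕ
𝟙 d = if does d then 1 else 0

𝟙≤1 : ∀ {a} {A : Set a} (d : Dec A) → 𝟙 d ≤ 1
𝟙≤1 (yes _) = s≤s z≤n
𝟙≤1 (no _) = z≤n

𝟙-pos⇒holds : ∀ {a} {A : Set a} (d : Dec A) → 0 < 𝟙 d → A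
𝟙-pos⇒holds (yes a) _ = a

+-pos⇒⊎ : ∀ m n → 0 < m + n → 0 < m ⊎ 0 < n
+-pos⇒⊎ zero n 0<n = inj₂ 0<n
+-pos⇒⊎ (suc m) n _ = inj₁ (s≤s z≤n)

2*m≤n⇒m≤n/2 : ∀ m n → 2 * m ≤ n → m ≤ n / 2
2*m≤n⇒m≤n/2 m n 2m≤n = subst (_≤ n / 2) (m*n/n≡m m 2) (/-monoˡ-≤ 2 (subst (_≤ n) (*-comm 2 m) 2m≤n))

∀⊎⇒⊎∀ : ∀ n {p} {P : Fin n → Set p} {G : Set} → (∀ i → P i ⊎ G) → (∀ i → P i) ⊎ G
∀⊎⇒⊎∀ zero h = inj₁ λ ()
∀⊎⇒⊎∀ (suc n) {P = P} h with h zero | ∀⊎⇒⊎∀ n {P = P ∘ suc} (h ∘ suc)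
... | inj₂ g  | _          = inj₂ g
... | inj₁ _  | inj₂ g     = inj₂ g
... | inj₁ p₀ | inj₁ pₛ    = inj₁ λ { zero → p₀ ; (suc i) → pₛ i }

∑ : ∀ {A : Set} → List A → (A → ℕ) → ℕ
∑ xs f = sum (map f xs)

module _ {A : Set} where

  ∑-cong : ∀ (xs : List A) {f g : A → ℕ} → (∀ x → f x ≡ g x) → ∑ xs f ≡ ∑ xs g
  ∑-cong [] _ = refl
  ∑-cong (x ∷ xs) f≡g = cong₂ _+_ (f≡g x) (∑-cong xs f≡g)

  ∑-mono-≤ : ∀ (xs : List A) {f g : A → ℕ} → (∀ x → f x ≤ g x) → ∑ xs f ≤ ∑ xs g
  ∑-mono-≤ [] _ = z≤n
  ∑-mono-≤ (x ∷ xs) f≤g = +-mono-≤ (f≤g x) (∑-mono-≤ xs f≤g)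

  ∑-distrib-+ : ∀ (xs : List A) (f g : A → ℕ) → ∑ xs (λ x → f x + g x) ≡ ∑ xs f + ∑ xs g
  ∑-distrib-+ [] f g = refl
  ∑-distrib-+ (x ∷ xs) f g =
    trans (cong (f x + g x +_) (∑-distrib-+ xs f g)) (interchange (f x) (g x) (∑ xs f) (∑ xs g))

  ∑-distribʳ-* : ∀ (xs : List A) (f : A → ℕ) c → ∑ xs (λ x → f x * c) ≡ ∑ xs f * c
  ∑-distribʳ-* [] f c = refl
  ∑-distribʳ-* (x ∷ xs) f c =
    trans (cong (f x * c +_) (∑-distribʳ-* xs f c)) (sym (*-distribʳ-+ c (f x) (∑ xs f)))

  ∑-const : ∀ (xs : List A) c → ∑ xs (λ _ → c) ≡ length xs * c
  ∑-const [] c = refl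
  ∑-const (x ∷ xs) c = cong (c +_) (∑-const xs c)

  ∑-zero : ∀ (xs : List A) → ∑ xs (λ _ → 0) ≡ 0
  ∑-zero xs = trans (∑-const xs 0) (*-zeroʳ (length xs))

  ∑-++ : ∀ (xs ys : List A) f → ∑ (xs ++ ys) f ≡ ∑ xs f + ∑ ys f
  ∑-++ xs ys f = trans (cong sum (map-++ f xs ys)) (sum-++ (map f xs) (map f ys))

  length-filter≡∑𝟙 : ∀ {p} {P : A → Set p} (P? : ∀ x → Dec (P x)) (xs : List A) →
    length (filter P? xs) ≡ ∑ xs (𝟙 ∘ P?)
  length-filter≡∑𝟙 P? [] = refl
  length-filter≡∑𝟙 P? (x ∷ xs) with P? x
  ... | yes _ = cong suc (length-filter≡∑𝟙 P? xs)
  ... | no _  = length-filter≡∑𝟙 P? xs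

module _ {A B : Set} where

  ∑-comm : ∀ (xs : List A) (ys : List B) (h : A → B → ℕ) →
    ∑ xs (λ x → ∑ ys (h x)) ≡ ∑ ys (λ y → ∑ xs (λ x → h x y))
  ∑-comm [] ys h = sym (∑-zero ys)
  ∑-comm (x ∷ xs) ys h = trans (cong (∑ ys (h x) +_) (∑-comm xs ys h))
    (sym (∑-distrib-+ ys (h x) (λ y → ∑ xs (λ x → h x y))))

  ∑-concatMap : ∀ (h : A → List B) (xs : List A) f →
    ∑ (concatMap h xs) f ≡ ∑ xs (λ x → ∑ (h x) f)
  ∑-concatMap h [] f = refl
  ∑-concatMap h (x ∷ xs) f =
    trans (∑-++ (h x) (concatMap h xs) f) (cong (∑ (h x) f +_) (∑-concatMap h xs f))

  ∑-mapMaybe : ∀ (m : A → Maybe B) (xs : List A) f →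
    ∑ (mapMaybe m xs) f ≡ ∑ xs (λ x → maybe′ f 0 (m x))
  ∑-mapMaybe m [] f = refl
  ∑-mapMaybe m (x ∷ xs) f with m x
  ... | just y  = cong (f y +_) (∑-mapMaybe m xs f)
  ... | nothing = ∑-mapMaybe m xs f

∑Fin : ∀ n → (Fin n → ℕ) → ℕ
∑Fin n = ∑ (allFin n)

∑Fin-suc : ∀ n (f : Fin (suc n) → ℕ) → ∑Fin (suc n) f ≡ f zero + ∑Fin n (f ∘ suc)
∑Fin-suc n f = cong (f zero +_) (cong sum (trans (map-tabulate suc f) (sym (map-tabulate (λ i → i) (f ∘ suc)))))

∑Fin-const : ∀ n c → ∑Fin n (λ _ → c) ≡ n * c
∑Fin-const n c = trans (∑-const (allFin n) c) (cong (_* c) (length-tabulate {n = n} (λ i → i)))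

∑Fin-𝟙≡-* : ∀ n (x : Fin n) (f : Fin n → ℕ) → ∑Fin n (λ i → 𝟙 (x Finₚ.≟ i) * f i) ≡ f x
∑Fin-𝟙≡-* (suc n) zero f = begin
    ∑Fin (suc n) (λ i → 𝟙 (zero Finₚ.≟ i) * f i) ≡⟨ ∑Fin-suc n (λ i → 𝟙 (zero Finₚ.≟ i) * f i) ⟩
    f zero + 0 + ∑Fin n (λ _ → 0)                  ≡⟨ cong₂ _+_ (+-identityʳ (f zero)) (∑-zero (allFin n)) ⟩
    f zero + 0                                     ≡⟨ +-identityʳ (f zero) ⟩
    f zero                                         ∎
  where open ≡-Reasoning
∑Fin-𝟙≡-* (suc n) (suc x) f =
  trans (∑Fin-suc n (λ i → 𝟙 (suc x Finₚ.≟ i) * f i)) (∑Fin-𝟙≡-* n x (f ∘ suc))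

∣p∣≡∑𝟙∈ : ∀ {r} (p : Subset r) → ∣ p ∣ ≡ ∑Fin r (λ c → 𝟙 (c ∈? p))
∣p∣≡∑𝟙∈ {zero} [] = refl
∣p∣≡∑𝟙∈ {suc r} (true ∷ p) = trans (cong suc (∣p∣≡∑𝟙∈ p)) (sym (∑Fin-suc r (λ c → 𝟙 (c ∈? (true ∷ p)))))
∣p∣≡∑𝟙∈ {suc r} (false ∷ p) = trans (∣p∣≡∑𝟙∈ p) (sym (∑Fin-suc r (λ c → 𝟙 (c ∈? (false ∷ p)))))

∑Fin-pos⇒∃ : ∀ n (f : Fin n → ℕ) → 0 < ∑Fin n f → ∃ λ i → 0 < f i
∑Fin-pos⇒∃ (suc n) f pos with +-pos⇒⊎ (f zero) _ (subst (0 <_) (∑Fin-suc n f) pos)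
... | inj₁ f₀>0 = zero , f₀>0
... | inj₂ rest>0 with ∑Fin-pos⇒∃ n (f ∘ suc) rest>0
...   | i , fᵢ>0 = suc i , fᵢ>0

TwoPositive : ∀ {n} → (Fin n → ℕ) → Set
TwoPositive {n} f = Σ (Fin n) λ i → Σ (Fin n) λ j → i ≢ j × 0 < f i × 0 < f j

∑Fin≤1⊎TwoPositive : ∀ n (f : Fin n → ℕ) → (∀ i → f i ≤ 1) → ∑Fin n f ≤ 1 ⊎ TwoPositive f
∑Fin≤1⊎TwoPositive zero f _ = inj₁ z≤n
∑Fin≤1⊎TwoPositive (suc n) f f≤1 with ∑Fin≤1⊎TwoPositive n (f ∘ suc) (f≤1 ∘ suc)
... | inj₂ (i , j , i≢j , fᵢ>0 , fⱼ>0) = inj₂ (suc i , suc j , i≢j ∘ Finₚ.suc-injective , fᵢ>0 , fⱼ>0)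
... | inj₁ rest≤1 with f zero ≤? 0 | ∑Fin n (f ∘ suc) ≤? 0
...   | yes f₀≤0 | _ = inj₁ (≤-trans (≤-reflexive (∑Fin-suc n f)) (+-mono-≤ f₀≤0 rest≤1))
...   | no _ | yes rest≤0 =
        inj₁ (≤-trans (≤-reflexive (∑Fin-suc n f)) (+-mono-≤ (f≤1 zero) rest≤0))
...   | no f₀≰0 | no rest≰0 with ∑Fin-pos⇒∃ n (f ∘ suc) (≰⇒> rest≰0)
...     | j , fⱼ>0 = inj₂ (zero , suc j , (λ ()) , ≰⇒> f₀≰0 , fⱼ>0)

-- An edge weight read as a k × k matrix; it vanishes off the strict upper triangle.
onPair : ∀ {k} → (Edge k → ℕ) → Fin k → Fin k → ℕ
onPair g u v = maybe′ g 0 (mkEdge u v)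

∑-edges : ∀ k (g : Edge k → ℕ) → ∑ (edges k) g ≡ ∑Fin k (λ u → ∑Fin k (onPair g u))
∑-edges k g = trans (∑-concatMap _ (allFin k) g)
  (∑-cong (allFin k) (λ u → ∑-mapMaybe (mkEdge u) (allFin k) g))

weightedSum≡∑-edges : ∀ {k j} (cls : Edge k → Fin j) (s : Fin j → ℕ) →
  weightedSum cls s ≡ ∑ (edges k) (s ∘ cls)
weightedSum≡∑-edges {k} {j} cls s = begin
  weightedSum cls s
    ≡⟨ ∑-cong (allFin j) (λ i → trans (cong (_* s i) (length-filter≡∑𝟙 (λ e → cls e Finₚ.≟ i) E))
                                     (sym (∑-distribʳ-* E (λ e → 𝟙 (cls e Finₚ.≟ i)) (s i)))) ⟩
  ∑ (allFin j) (λ i → ∑ E (λ e → 𝟙 (cls e Finₚ.≟ i) * s i))  ≡⟨ ∑-comm (allFin j) E _ ⟩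
  ∑ E (λ e → ∑Fin j (λ i → 𝟙 (cls e Finₚ.≟ i) * s i))        ≡⟨ ∑-cong E (λ e → ∑Fin-𝟙≡-* j (cls e) s) ⟩
  ∑ E (s ∘ cls)                                               ∎
  where
  E = edges k
  open ≡-Reasoning

IntersectingTriangle : ∀ r k → (Edge k → Subset r) → Set
IntersectingTriangle r k L = Σ (Fin k) λ a → Σ (Fin k) λ b → Σ (Fin k) λ c →
    Σ (a Fin.< b) λ ab → Σ (b Fin.< c) λ bc → Σ (a Fin.< c) λ ac →
    Nonempty (L ((a , b) , ab) ∩ L ((a , c) , ac))
    ⊎ (Nonempty (L ((a , b) , ab) ∩ L ((b , c) , bc))
    ⊎ Nonempty (L ((a , c) , ac) ∩ L ((b , c) , bc)))

module ColourClass {r k : ℕ} (L : Edge k → Subset r) (c : Fin r) where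

  Coloured : Fin k → Fin k → Set
  Coloured u v = Σ (u Fin.< v) (λ u<v → c ∈ L ((u , v) , u<v))
               ⊎ Σ (v Fin.< u) (λ v<u → c ∈ L ((v , u) , v<u))

  coloured-star⇒IntersectingTriangle : ∀ u v w → Coloured u v → Coloured u w → v ≢ w →
    IntersectingTriangle r k L
  coloured-star⇒IntersectingTriangle u v w (inj₁ (uv , x)) (inj₁ (uw , y)) v≢w with Finₚ.<-cmp v w
  ... | tri< vw _ _ = u , v , w , uv , vw , uw , inj₁ (c , x∈p∩q⁺ (x , y))
  ... | tri≈ _ v≡w _ = ⊥-elim (v≢w v≡w)
  ... | tri> _ _ wv = u , w , v , uw , wv , uv , inj₁ (c , x∈p∩q⁺ (y , x))
  coloured-star⇒IntersectingTriangle u v w (inj₁ (uv , x)) (inj₂ (wu , y)) _ =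
    w , u , v , wu , uv , Finₚ.<-trans wu uv , inj₂ (inj₁ (c , x∈p∩q⁺ (y , x)))
  coloured-star⇒IntersectingTriangle u v w (inj₂ (vu , x)) (inj₁ (uw , y)) _ =
    v , u , w , vu , uw , Finₚ.<-trans vu uw , inj₂ (inj₁ (c , x∈p∩q⁺ (x , y)))
  coloured-star⇒IntersectingTriangle u v w (inj₂ (vu , x)) (inj₂ (wu , y)) v≢w with Finₚ.<-cmp v w
  ... | tri< vw _ _ = v , w , u , vw , wu , vu , inj₂ (inj₂ (c , x∈p∩q⁺ (x , y)))
  ... | tri≈ _ v≡w _ = ⊥-elim (v≢w v≡w)
  ... | tri> _ _ wv = w , v , u , wv , vu , wu , inj₂ (inj₂ (c , x∈p∩q⁺ (y , x)))

  inClass : Edge k → ℕ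
  inClass e = 𝟙 (c ∈? L e)

  onPair-pos⇒coloured : ∀ u v → 0 < onPair inClass u v → Σ (u Fin.< v) (λ u<v → c ∈ L ((u , v) , u<v))
  onPair-pos⇒coloured u v pos with u Fin.<? v
  ... | yes u<v = u<v , 𝟙-pos⇒holds (c ∈? L ((u , v) , u<v)) pos

  adjacency : Fin k → Fin k → ℕ
  adjacency u v = onPair inClass u v + onPair inClass v u

  adjacency≤1 : ∀ u v → adjacency u v ≤ 1
  adjacency≤1 u v with u Fin.<? v | v Fin.<? u
  ... | yes u<v | yes v<u = ⊥-elim (Finₚ.<-asym u<v v<u)
  ... | yes u<v | no _    = subst (_≤ 1) (sym (+-identityʳ _)) (𝟙≤1 (c ∈? L ((u , v) , u<v)))
  ... | no _    | yes v<u = 𝟙≤1 (c ∈? L ((v , u) , v<u))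
  ... | no _    | no _    = z≤n

  adjacency-pos⇒coloured : ∀ u v → 0 < adjacency u v → Coloured u v
  adjacency-pos⇒coloured u v pos with +-pos⇒⊎ (onPair inClass u v) _ pos
  ... | inj₁ uv>0 = inj₁ (onPair-pos⇒coloured u v uv>0)
  ... | inj₂ vu>0 = inj₂ (onPair-pos⇒coloured v u vu>0)

  degree≤1⊎IntersectingTriangle : ∀ u → ∑Fin k (adjacency u) ≤ 1 ⊎ IntersectingTriangle r k L
  degree≤1⊎IntersectingTriangle u with ∑Fin≤1⊎TwoPositive k (adjacency u) (adjacency≤1 u)
  ... | inj₁ degree≤1 = inj₁ degree≤1
  ... | inj₂ (v , w , v≢w , uv>0 , uw>0) = inj₂ (coloured-star⇒IntersectingTriangle u v w
          (adjacency-pos⇒coloured u v uv>0) (adjacency-pos⇒coloured u w uw>0) v≢w)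

  -- Handshake lemma: each coloured edge is counted once from each endpoint.
  matching≤half : (∀ u → ∑Fin k (adjacency u) ≤ 1) → ∑ (edges k) inClass ≤ k / 2
  matching≤half degree≤1 = subst (_≤ k / 2) (sym (∑-edges k inClass)) (2*m≤n⇒m≤n/2 M k 2M≤k)
    where
    M = ∑Fin k (λ u → ∑Fin k (onPair inClass u))
    open ≤-Reasoning
    2M≤k : 2 * M ≤ k
    2M≤k = begin
      M + (M + 0)
        ≡⟨ cong (λ n → M + n) (trans (+-identityʳ M) (∑-comm (allFin k) (allFin k) (onPair inClass))) ⟩
      M + ∑Fin k (λ u → ∑Fin k (λ v → onPair inClass v u))
        ≡⟨ sym (∑-distrib-+ (allFin k) _ _) ⟩
      ∑Fin k (λ u → ∑Fin k (onPair inClass u) + ∑Fin k (λ v → onPair inClass v u))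
        ≡⟨ ∑-cong (allFin k) (λ u → sym (∑-distrib-+ (allFin k) _ _)) ⟩
      ∑Fin k (λ u → ∑Fin k (adjacency u))  ≤⟨ ∑-mono-≤ (allFin k) degree≤1 ⟩
      ∑Fin k (λ _ → 1)                     ≡⟨ ∑Fin-const k 1 ⟩
      k * 1                                ≡⟨ *-identityʳ k ⟩
      k                                    ∎

open ColourClass using (inClass; adjacency; degree≤1⊎IntersectingTriangle; matching≤half)

∑-listSizes≡∑-colourClasses : ∀ {r k} (L : Edge k → Subset r) →
  ∑ (edges k) (∣_∣ ∘ L) ≡ ∑Fin r (λ c → ∑ (edges k) (inClass L c))
∑-listSizes≡∑-colourClasses {r} {k} L =
  trans (∑-cong (edges k) (∣p∣≡∑𝟙∈ ∘ L)) (∑-comm (edges k) (allFin r) _)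

weightedSum≤r*half : ∀ {r k j} (cls : Edge k → Fin j) (s : Fin j → ℕ) (L : Edge k → Subset r) →
  (∀ e → s (cls e) ≤ ∣ L e ∣) → (∀ c u → ∑Fin k (adjacency L c u) ≤ 1) →
  weightedSum cls s ≤ r * (k / 2)
weightedSum≤r*half {r} {k} cls s L s≤∣L∣ degree≤1 = begin
  weightedSum cls s                          ≡⟨ weightedSum≡∑-edges cls s ⟩
  ∑ (edges k) (s ∘ cls)                      ≤⟨ ∑-mono-≤ (edges k) s≤∣L∣ ⟩
  ∑ (edges k) (∣_∣ ∘ L)                      ≡⟨ ∑-listSizes≡∑-colourClasses L ⟩
  ∑Fin r (λ c → ∑ (edges k) (inClass L c))   ≤⟨ ∑-mono-≤ (allFin r) (λ c → matching≤half L c (degree≤1 c)) ⟩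
  ∑Fin r (λ _ → k / 2)                       ≡⟨ ∑Fin-const r (k / 2) ⟩
  r * (k / 2)                                ∎
  where open ≤-Reasoning

lemma3p6 : (r k j : ℕ) → 1 ≤ r → 3 ≤ k → 1 ≤ j →
    (cls : Edge k → Fin j) → (∀ i → ∃ λ e → cls e ≡ i) →
    (s : Fin j → ℕ) → (∀ i → 1 ≤ s i × s i ≤ r) →
    r * (k / 2) < weightedSum cls s →
    (L : Edge k → Subset r) → (∀ e → s (cls e) ≤ ∣ L e ∣) →
    Σ (Fin k) λ a → Σ (Fin k) λ b → Σ (Fin k) λ c →
    Σ (Data.Fin._<_ a b) λ ab → Σ (Data.Fin._<_ b c) λ bc → Σ (Data.Fin._<_ a c) λ ac →
    Nonempty (L ((a , b) , ab) ∩ L ((a , c) , ac))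
    ⊎ (Nonempty (L ((a , b) , ab) ∩ L ((b , c) , bc))
    ⊎ Nonempty (L ((a , c) , ac) ∩ L ((b , c) , bc)))
lemma3p6 r k j _ _ _ cls _ s _ r*half<weightedSum L s≤∣L∣
  with ∀⊎⇒⊎∀ r (λ c → ∀⊎⇒⊎∀ k (degree≤1⊎IntersectingTriangle L c))
... | inj₂ triangle  = triangle
... | inj₁ degree≤1 = ⊥-elim (<⇒≱ r*half<weightedSum (weightedSum≤r*half cls s L s≤∣L∣ degree≤1))
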